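{- Let $G$ be a finite, connected, simple graph of order $n\ge 2$. Then $\phi(G)\le \Psi(G)\le \beta(G)+\phi(G)$.
   Context: $d_G$ denotes graph distance. A set $S\subseteq V(G)$ is resolving if for all distinct $u,v$ some $y\in S$ has $d_G(u,y)\neq d_G(v,y)$; $\beta(G)$ (the metric dimension) is the minimum size of a resolving set. A pair $\{x,y\}$ doubly resolves $\{u,v\}$ if $d_G(u,x)-d_G(u,y)\neq d_G(v,x)-d_G(v,y)$; $S$ is a doubly resolving set if every pair of distinct vertices is doubly resolved by some pair of vertices of $S$, and $\Psi(G)$ is the minimum size of a doubly resolving set. For a vertex $x$, $T\subseteq V(G)$ is a doubly distance resolving set of $G$ on $x$ if every pair $\{u,v\}$ with $d_G(u,x)\neq d_G(v,x)$ is doubly resolved by some pair of vertices of $T\cup\{x\}$; $\phi(G,x)$ is the minimum size of such a set, and $\phi(G)=\max\{\phi(G,x):x\in V(G)\}$. -}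

module Defs where

open import Data.Nat using (ℕ; zero; suc; _≤_; _+_)
open import Data.Bool using (Bool; true; false; _∧_; _∨_; if_then_else_)
open import Data.Fin using (Fin)
open import Data.Fin.Properties using (_≟_)
open import Data.Fin.Subset using (Subset; _∈_; _∪_; ⁅_⁆; ∣_∣)
open import Data.List using (allFin)
open import Data.Bool.ListAction using (any)
open import Data.Integer using (ℤ; +_; _-_)
open import Data.Product using (Σ; ∃; _×_)
open import Relation.Nullary using (¬_)
open import Relation.Nullary.Decidable using (⌊_⌋)
open import Relation.Binary.PropositionalEquality using (_≡_; _≢_)

record Graph (n : ℕ) : Set where
  field
    adj     : Fin n → Fin n → Bool
    adj-sym : ∀ u v → adj u v ≡ adj v u
    irrefl  : ∀ u → adj u u ≡ false
open Graph public

module _ {n : ℕ} (G : Graph n) where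

  reach : ℕ → Fin n → Fin n → Bool
  reach zero    u v = ⌊ u ≟ v ⌋
  reach (suc k) u v = reach k u v ∨ any (λ w → reach k u w ∧ adj G w v) (allFin n)

  Connected : Set
  Connected = ∀ u v → ∃ λ k → reach k u v ≡ true

  private
    firstReach : ℕ → ℕ → Fin n → Fin n → ℕ
    firstReach i zero       u v = i
    firstReach i (suc fuel) u v =
      if reach i u v then i else firstReach (suc i) fuel u v

  -- graph distance d_G(u,v): the least number of edges of a u-v walk
  -- (in a connected graph on n vertices this is < n, so the search is exhaustive).
  dist : Fin n → Fin n → ℕ
  dist u v = firstReach 0 n u v

  Resolves : Subset n → Set
  Resolves S = ∀ u v → u ≢ v → ∃ λ y → y ∈ S × dist u y ≢ dist v y

  IsMetricDim : ℕ → Set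
  IsMetricDim k = (∃ λ S → Resolves S × ∣ S ∣ ≡ k)
                × (∀ S → Resolves S → k ≤ ∣ S ∣)

  DoublyResolves : Fin n → Fin n → Fin n → Fin n → Set
  DoublyResolves x y u v =
    (+ dist u x) - (+ dist u y) ≢ (+ dist v x) - (+ dist v y)

  DoublyResolving : Subset n → Set
  DoublyResolving S = ∀ u v → u ≢ v →
    ∃ λ x → ∃ λ y → x ∈ S × y ∈ S × DoublyResolves x y u v

  IsDoublyMetricDim : ℕ → Set
  IsDoublyMetricDim k = (∃ λ S → DoublyResolving S × ∣ S ∣ ≡ k)
                      × (∀ S → DoublyResolving S → k ≤ ∣ S ∣)

  DoublyDistResolvingOn : Fin n → Subset n → Set
  DoublyDistResolvingOn x T = ∀ u v → dist u x ≢ dist v x →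
    ∃ λ a → ∃ λ b → a ∈ (T ∪ ⁅ x ⁆) × b ∈ (T ∪ ⁅ x ⁆) × DoublyResolves a b u v

  IsPhiAt : Fin n → ℕ → Set
  IsPhiAt x k = (∃ λ T → DoublyDistResolvingOn x T × ∣ T ∣ ≡ k)
              × (∀ T → DoublyDistResolvingOn x T → k ≤ ∣ T ∣)

  IsPhi : ℕ → Set
  IsPhi k = (∃ λ x → IsPhiAt x k) × (∀ x k' → IsPhiAt x k' → k' ≤ k)

-- Any doubly resolving set is a doubly distance resolving set on every
-- vertex, which gives φ(G) ≤ Ψ(G).  Conversely, let R be a metric basis,
-- y ∈ R, and T a smallest doubly distance resolving set on y.  Then R ∪ T is
-- doubly resolving: pairs at different distances from y are handled by
-- T ∪ {y}, and a pair u, v at equal distance from y is separated by some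
-- z ∈ R, so that {z, y} doubly resolves it.  Hence Ψ(G) ≤ |R| + |T| ≤ β(G) + φ(G).
module Submission where

open import Defs
open import Data.Fin using (Fin; zero; suc)
import Data.Fin.Properties as Fin
open import Data.Fin.Subset using (Subset; _∈_; _∪_; ⁅_⁆; ∣_∣; inside; outside)
open import Data.Fin.Subset.Properties using (_∈?_; anySubset?; p⊆p∪q; q⊆p∪q; x∈p∪q⁻; x∈⁅y⁆⇒x≡y)
open import Data.Integer as ℤ using (+_; _-_)
open import Data.Integer.Properties using (+-injective; +-0-abelianGroup)
open import Algebra.Properties.AbelianGroup +-0-abelianGroup using (∙-cancelʳ)
open import Data.Nat using (ℕ; zero; suc; _≤_; _<_; _+_; z≤n; s≤s)
import Data.Nat.Properties as ℕ
open import Data.Product using (_×_; _,_; ∃)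
open import Data.Sum using (inj₁; inj₂)
open import Data.Vec using (_∷_; [])
open import Relation.Nullary using (¬_; Dec; yes; no)
open import Relation.Nullary.Decidable using (¬?; _×-dec_; _→-dec_)
open import Relation.Unary using (Decidable)
open import Relation.Binary.PropositionalEquality using (_≡_; _≢_; refl; sym; subst)

∣p∪q∣≤∣p∣+∣q∣ : ∀ {m} (p q : Subset m) → ∣ p ∪ q ∣ ≤ ∣ p ∣ + ∣ q ∣
∣p∪q∣≤∣p∣+∣q∣ []            []            = z≤n
∣p∪q∣≤∣p∣+∣q∣ (inside ∷ p)  (inside ∷ q)  = s≤s (ℕ.≤-trans (∣p∪q∣≤∣p∣+∣q∣ p q) (ℕ.+-monoʳ-≤ ∣ p ∣ (ℕ.n≤1+n ∣ q ∣)))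
∣p∪q∣≤∣p∣+∣q∣ (inside ∷ p)  (outside ∷ q) = s≤s (∣p∪q∣≤∣p∣+∣q∣ p q)
∣p∪q∣≤∣p∣+∣q∣ (outside ∷ p) (inside ∷ q)  = ℕ.≤-trans (s≤s (∣p∪q∣≤∣p∣+∣q∣ p q)) (ℕ.≤-reflexive (sym (ℕ.+-suc ∣ p ∣ ∣ q ∣)))
∣p∪q∣≤∣p∣+∣q∣ (outside ∷ p) (outside ∷ q) = ∣p∪q∣≤∣p∣+∣q∣ p q

Least : (ℕ → Set) → ℕ → Set
Least P k = P k × (∀ i → i < k → ¬ P i)

module _ {P : ℕ → Set} (P? : Decidable P) where

  private
    search : ∀ j d → (∀ i → i < j → ¬ P i) → P (d + j) → ∃ (Least P)
    search j zero    below pj = j , pj , below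
    search j (suc d) below p with P? j
    ... | yes pj = j , pj , below
    ... | no ¬pj = search (suc j) d below′ (subst P (sym (ℕ.+-suc d j)) p)
      where
      below′ : ∀ i → i < suc j → ¬ P i
      below′ i i<1+j with ℕ.m<1+n⇒m<n∨m≡n i<1+j
      ... | inj₁ i<j  = below i i<j
      ... | inj₂ refl = ¬pj

  least-exists : ∀ {k} → P k → ∃ (Least P)
  least-exists {k} pk = search 0 k (λ _ ()) (subst P (sym (ℕ.+-identityʳ k)) pk)

resolving-nonempty : ∀ {n} (G : Graph n) {R : Subset n} → 2 ≤ n → Resolves G R → ∃ (_∈ R)
resolving-nonempty G (s≤s (s≤s _)) resR with resR zero (suc zero) (λ ())
... | y , y∈R , _ = y , y∈R

module _ {n : ℕ} (G : Graph n) where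

  doublyResolves? : ∀ a b u v → Dec (DoublyResolves G a b u v)
  doublyResolves? a b u v = ¬? ((+ dist G u a - + dist G u b) ℤ.≟ (+ dist G v a - + dist G v b))

  doublyDistResolvingOn? : ∀ x → Decidable (DoublyDistResolvingOn G x)
  doublyDistResolvingOn? x T = Fin.all? λ u → Fin.all? λ v →
    ¬? (dist G u x ℕ.≟ dist G v x) →-dec
      Fin.any? λ a → Fin.any? λ b →
        (a ∈? (T ∪ ⁅ x ⁆)) ×-dec (b ∈? (T ∪ ⁅ x ⁆)) ×-dec doublyResolves? a b u v

  isPhiAt-exists : ∀ {x T} → DoublyDistResolvingOn G x T → ∃ (IsPhiAt G x)
  isPhiAt-exists {x} {T} ddrT with least-exists sized? (T , ddrT , refl)
    where
    sized? : Decidable (λ k → ∃ λ T → DoublyDistResolvingOn G x T × ∣ T ∣ ≡ k)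
    sized? k = anySubset? (λ T → doublyDistResolvingOn? x T ×-dec (∣ T ∣ ℕ.≟ k))
  ... | k , realised , smaller = k , realised , λ T′ ddrT′ → ℕ.≮⇒≥ (λ lt → smaller ∣ T′ ∣ lt (T′ , ddrT′ , refl))

  doublyResolving⇒doublyDistResolvingOn : ∀ {S} x → DoublyResolving G S → DoublyDistResolvingOn G x S
  doublyResolving⇒doublyDistResolvingOn x drS u v ux≢vx
    with drS u v (λ { refl → ux≢vx refl })
  ... | a , b , a∈S , b∈S , dr = a , b , p⊆p∪q ⁅ x ⁆ a∈S , p⊆p∪q ⁅ x ⁆ b∈S , dr

  doublyResolves-of-equidistant : ∀ {z y u v} → dist G u y ≡ dist G v y →
    dist G u z ≢ dist G v z → DoublyResolves G z y u v
  doublyResolves-of-equidistant {z} {y} {u} {v} uy≡vy uz≢vz eq =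
    uz≢vz (+-injective (∙-cancelʳ (ℤ.- + dist G v y) (+ dist G u z) (+ dist G v z)
      (subst (λ d → + dist G u z - + d ≡ + dist G v z - + dist G v y) uy≡vy eq)))

  resolving∪doublyDistResolving : ∀ {R T y} → y ∈ R → Resolves G R →
    DoublyDistResolvingOn G y T → DoublyResolving G (R ∪ T)
  resolving∪doublyDistResolving {R} {T} {y} y∈R resR ddrT u v u≢v
    with dist G u y ℕ.≟ dist G v y
  ... | no uy≢vy with ddrT u v uy≢vy
  ...   | a , b , a∈ , b∈ , dr = a , b , lift a∈ , lift b∈ , dr
    where
    lift : ∀ {a} → a ∈ (T ∪ ⁅ y ⁆) → a ∈ (R ∪ T)
    lift a∈ with x∈p∪q⁻ T ⁅ y ⁆ a∈
    ... | inj₁ a∈T = q⊆p∪q R T a∈T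
    ... | inj₂ a∈y with x∈⁅y⁆⇒x≡y y a∈y
    ...   | refl = p⊆p∪q T y∈R
  resolving∪doublyDistResolving {R} {T} {y} y∈R resR ddrT u v u≢v | yes uy≡vy
    with resR u v u≢v
  ... | z , z∈R , uz≢vz =
    z , y , p⊆p∪q T z∈R , p⊆p∪q T y∈R , doublyResolves-of-equidistant uy≡vy uz≢vz

  phi≤doublyResolving : ∀ {f S} → IsPhi G f → DoublyResolving G S → f ≤ ∣ S ∣
  phi≤doublyResolving ((x , _ , minimal) , _) drS =
    minimal _ (doublyResolving⇒doublyDistResolvingOn x drS)

  doublyMetricDim≤metricDim+phi : ∀ {b ψ f} → 2 ≤ n →
    IsMetricDim G b → IsDoublyMetricDim G ψ → IsPhi G f → ψ ≤ b + f
  doublyMetricDim≤metricDim+phi {ψ = ψ} {f = f} 2≤n ((R , resR , refl) , _) ((S , drS , _) , minimal) (_ , maximal)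
    with resolving-nonempty G 2≤n resR
  ... | y , y∈R with isPhiAt-exists (doublyResolving⇒doublyDistResolvingOn y drS)
  ... | k , isPhiAt@((T , ddrT , refl) , _) = begin
    ψ             ≤⟨ minimal (R ∪ T) (resolving∪doublyDistResolving y∈R resR ddrT) ⟩
    ∣ R ∪ T ∣     ≤⟨ ∣p∪q∣≤∣p∣+∣q∣ R T ⟩
    ∣ R ∣ + ∣ T ∣ ≤⟨ ℕ.+-monoʳ-≤ ∣ R ∣ (maximal y k isPhiAt) ⟩
    ∣ R ∣ + f     ∎
    where open ℕ.≤-Reasoning

theorem6 : (n : ℕ) → 2 ≤ n → (G : Graph n) → Connected G →
    (b ψ f : ℕ) → IsMetricDim G b → IsDoublyMetricDim G ψ → IsPhi G f →
    f ≤ ψ × ψ ≤ b + f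
theorem6 n 2≤n G _ b ψ f isβ isΨ@((S , drS , refl) , _) isφ =
  phi≤doublyResolving G isφ drS , doublyMetricDim≤metricDim+phi G 2≤n isβ isΨ isφ
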